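{- For $i=1,2$, let $G_i=(V_i,E_i)$ be a matching-covered graph with $|E_i|\ge2$ and let $S_i$ be an equivalent set of $G_i$ with $e_i\in S_i$, where $e_i=x_iy_i$; assume $G_1,G_2$ are vertex-disjoint. Let $G$ be the graph obtained from $G_1-e_1$ and $G_2-e_2$ by adding edges $f_1=x_1x_2$ and $f_2=y_1y_2$, and let $S=(S_1-\{e_1\})\cup(S_2-\{e_2\})\cup\{f_1,f_2\}$. Then: (i) $G$ is matching-covered; (ii) $S$ is an equivalent set of $G$; (iii) if $G_1$ and $G_2$ are 2-connected, then $G$ is 2-connected; (iv) if $G_1$ and $G_2$ are $r$-regular graphs of class 1, then $G$ is an $r$-regular graph of class 1; (v) for any $S'\subseteq S$, if $G_i-e_i-(S'\cap E_i)$ is not bipartite for some $i\in\{1,2\}$, then $S'\not\sim_G E(G)$; (vi) for any $S'\subseteq S$, if $S'\cap E_j\not\sim_{G_j-e_j}\emptyset$ for some $j\in\{1,2\}$, then $S'\not\sim_G\emptyset$.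
   Context: A graph is matching-covered if connected and every edge lies in a perfect matching. A non-empty edge set $S$ of a graph $H$ is an equivalent set if $S\cap M=\emptyset$ or $S\cap M=S$ for every perfect matching $M$ of $H$. A graph is of class 1 if its edge chromatic number equals its maximum degree. $\nabla_H(U)$ is the set of edges of $H$ with exactly one end in $U$; $X\sim_H Y$ means $X=Y\oplus\nabla_H(U)$ for some $U\subseteq V(H)$ ($\oplus$ = symmetric difference), and $\not\sim_H$ is its negation. -}

module Defs where

open import Data.Nat using (ℕ; zero; suc; _+_; _≤_; _⊔_)
open import Data.Fin using (Fin; _↑ˡ_; _↑ʳ_; splitAt; _≟_)
open import Data.Bool using (Bool; true; false; _xor_; not; _∧_; if_then_else_)
open import Data.Product using (Σ; ∃; _×_; _,_; proj₁; proj₂)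
open import Data.Sum using (_⊎_; inj₁; inj₂; [_,_]′)
open import Relation.Binary.PropositionalEquality using (_≡_; _≢_)
open import Relation.Binary.Construct.Closure.ReflexiveTransitive using (Star)
open import Relation.Nullary using (does; ¬_)

-- Finite (multi)graphs: vertices Fin n, edges Fin m, each edge has two
-- ends (an edge x y is stored as an ordered pair, orientation irrelevant).
-- Parallel edges are allowed; loops are not excluded by the type, but a
-- matching-covered graph has none (loops lie in no perfect matching).

record Graph : Set where
  field
    n    : ℕ
    m    : ℕ
    ends : Fin m → Fin n × Fin n

open Graph public

Vertex : Graph → Set
Vertex G = Fin (n G)

Edge : Graph → Set
Edge G = Fin (m G)

EdgeSet : Graph → Set
EdgeSet G = Edge G → Bool

VertexSet : Graph → Set
VertexSet G = Vertex G → Bool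

allEdges : (G : Graph) → EdgeSet G
allEdges G _ = true

noEdges : (G : Graph) → EdgeSet G
noEdges G _ = false

_⊆ₑ_ : {G : Graph} → EdgeSet G → EdgeSet G → Set
_⊆ₑ_ {G} X Y = ∀ (e : Edge G) → X e ≡ true → Y e ≡ true

Joins : (G : Graph) → Edge G → Vertex G → Vertex G → Set
Joins G e u v = ends G e ≡ (u , v) ⊎ ends G e ≡ (v , u)

Inc : (G : Graph) → Vertex G → Edge G → Set
Inc G v e = proj₁ (ends G e) ≡ v ⊎ proj₂ (ends G e) ≡ v

PerfectMatching : (G : Graph) → EdgeSet G → Set
PerfectMatching G M =
  (∀ e → M e ≡ true → proj₁ (ends G e) ≢ proj₂ (ends G e)) ×
  (∀ v → Σ (Edge G) λ e → M e ≡ true × Inc G v e ×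
            (∀ e′ → M e′ ≡ true → Inc G v e′ → e′ ≡ e))

Adj : (G : Graph) → Vertex G → Vertex G → Set
Adj G u v = Σ (Edge G) λ e → Joins G e u v

Connected : Graph → Set
Connected G = ∀ (u v : Vertex G) → Star (Adj G) u v

MatchingCovered : Graph → Set
MatchingCovered G =
  Connected G × (∀ (e : Edge G) → Σ (EdgeSet G) λ M → PerfectMatching G M × M e ≡ true)

EquivalentSet : (G : Graph) → EdgeSet G → Set
EquivalentSet G S =
  (Σ (Edge G) λ e → S e ≡ true) ×
  (∀ M → PerfectMatching G M →
     (∀ e → S e ≡ true → M e ≡ false) ⊎ (∀ e → S e ≡ true → M e ≡ true))

AdjAvoiding : (G : Graph) → Vertex G → Vertex G → Vertex G → Set
AdjAvoiding G w u v = Adj G u v × u ≢ w × v ≢ w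

TwoConnected : Graph → Set
TwoConnected G =
  3 ≤ n G × Connected G ×
  (∀ (w u v : Vertex G) → u ≢ w → v ≢ w → Star (AdjAvoiding G w) u v)

count : ∀ {k} → (Fin k → Bool) → ℕ
count {zero}  f = 0
count {suc k} f = (if f Data.Fin.zero then 1 else 0) + count (λ i → f (Data.Fin.suc i))

maxOver : ∀ {k} → (Fin k → ℕ) → ℕ
maxOver {zero}  f = 0
maxOver {suc k} f = f Data.Fin.zero ⊔ maxOver (λ i → f (Data.Fin.suc i))

-- degree (a loop would count twice)
degree : (G : Graph) → Vertex G → ℕ
degree G v = count (λ e → does (proj₁ (ends G e) ≟ v))
           + count (λ e → does (proj₂ (ends G e) ≟ v))

maxDegree : Graph → ℕ
maxDegree G = maxOver (degree G)

Regular : Graph → ℕ → Set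
Regular G r = ∀ (v : Vertex G) → degree G v ≡ r

ProperEdgeColouring : (G : Graph) (k : ℕ) → (Edge G → Fin k) → Set
ProperEdgeColouring G k c =
  ∀ e e′ → e ≢ e′ → (Σ (Vertex G) λ v → Inc G v e × Inc G v e′) → c e ≢ c e′

EdgeColourable : Graph → ℕ → Set
EdgeColourable G k = Σ (Edge G → Fin k) (ProperEdgeColouring G k)

IsEdgeChromaticNumber : Graph → ℕ → Set
IsEdgeChromaticNumber G k = EdgeColourable G k × (∀ j → EdgeColourable G j → k ≤ j)

Class1 : Graph → Set
Class1 G = IsEdgeChromaticNumber G (maxDegree G)

BipartiteSub : (G : Graph) → EdgeSet G → Set
BipartiteSub G K =
  Σ (VertexSet G) λ c → ∀ e → K e ≡ true → c (proj₁ (ends G e)) ≢ c (proj₂ (ends G e))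

∇ : (G : Graph) → VertexSet G → EdgeSet G
∇ G U e = U (proj₁ (ends G e)) xor U (proj₂ (ends G e))

SimSub : (G : Graph) → EdgeSet G → EdgeSet G → EdgeSet G → Set
SimSub G K X Y = Σ (VertexSet G) λ U → ∀ e → K e ≡ true → X e ≡ (Y e xor ∇ G U e)

Sim : (G : Graph) → EdgeSet G → EdgeSet G → Set
Sim G = SimSub G (allEdges G)

-- V(G) = V₁ ⊎ V₂ (as Fin (n₁ + n₂)),
-- E(G) = Fin (m₁ + m₂): the slot of e₁ carries f₁ = x₁x₂, the slot of e₂
-- carries f₂ = y₁y₂, all other slots carry the edges of G₁ - e₁, G₂ - e₂.

module _ (G₁ G₂ : Graph) where

  vL : Vertex G₁ → Fin (n G₁ + n G₂)
  vL v = v ↑ˡ n G₂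

  vR : Vertex G₂ → Fin (n G₁ + n G₂)
  vR v = n G₁ ↑ʳ v

  eL : Edge G₁ → Fin (m G₁ + m G₂)
  eL e = e ↑ˡ m G₂

  eR : Edge G₂ → Fin (m G₁ + m G₂)
  eR e = m G₁ ↑ʳ e

  glue : (e₁ : Edge G₁) (e₂ : Edge G₂) (x₁ y₁ : Vertex G₁) (x₂ y₂ : Vertex G₂) → Graph
  glue e₁ e₂ x₁ y₁ x₂ y₂ = record
    { n = n G₁ + n G₂
    ; m = m G₁ + m G₂
    ; ends = λ k → [ endsL , endsR ]′ (splitAt (m G₁) k)
    }
    where
      endsL : Edge G₁ → Fin (n G₁ + n G₂) × Fin (n G₁ + n G₂)
      endsL a = if does (a ≟ e₁) then (vL x₁ , vR x₂)
                else (vL (proj₁ (ends G₁ a)) , vL (proj₂ (ends G₁ a)))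
      endsR : Edge G₂ → Fin (n G₁ + n G₂) × Fin (n G₁ + n G₂)
      endsR b = if does (b ≟ e₂) then (vL y₁ , vR y₂)
                else (vR (proj₁ (ends G₂ b)) , vR (proj₂ (ends G₂ b)))

  glueSet : (e₁ : Edge G₁) (e₂ : Edge G₂) → EdgeSet G₁ → EdgeSet G₂ →
            Fin (m G₁ + m G₂) → Bool
  glueSet e₁ e₂ S₁ S₂ k =
    [ (λ a → if does (a ≟ e₁) then true else S₁ a)
    , (λ b → if does (b ≟ e₂) then true else S₂ b) ]′ (splitAt (m G₁) k)

  -- S′ ∩ E₁, S′ ∩ E₂ viewed as edge sets of G₁, G₂ (f₁, f₂ ∉ E_i, and the
  -- slots of e₁, e₂ are only consulted on edges of G_i - e_i)
  restrictL : (Fin (m G₁ + m G₂) → Bool) → EdgeSet G₁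
  restrictL S′ a = S′ (eL a)

  restrictR : (Fin (m G₁ + m G₂) → Bool) → EdgeSet G₂
  restrictR S′ b = S′ (eR b)

minusEdges : (G : Graph) → Edge G → EdgeSet G → EdgeSet G
minusEdges G e X a = not (does (a ≟ e)) ∧ not (X a)

minusEdge : (G : Graph) → Edge G → EdgeSet G
minusEdge G e a = not (does (a ≟ e))

-- A perfect matching M of the glued graph contains f₁ iff it contains f₂: otherwise M would pair
-- off the vertices of G₁ other than x₁, an odd number since G₁ has a perfect matching. So the
-- perfect matchings of G are the combinations of perfect matchings M₁ of G₁ and M₂ of G₂ with
-- e₁ ∈ M₁ ⇔ e₂ ∈ M₂, which gives (i) and (ii); G₂ has perfect matchings with and without e₂
-- because it is matching-covered with at least two edges. Connectivity in (i) and (iii) rests on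
-- e_i not being a bridge of G_i, again by a parity count. For (iv) degrees do not change, and
-- r-edge-colourings of G₁ and G₂ combine once the colours of G₂ are permuted so that e₁ and e₂
-- agree. For (v) and (vi), a witness U for G restricts to a witness for G_i - e_i.

module Submission where

open import Defs
open import Data.Nat using (ℕ; zero; suc; _+_; _⊔_; _≤_; _<_; z≤n; s≤s)
open import Data.Nat.Properties using (≤-trans; n≤1+n; suc-injective; +-suc; +-comm; +-assoc; n≮n; <-≤-trans; +-0-commutativeMonoid; +-commutativeSemigroup; ⊔-idem; ⊔-identityʳ; m≤m+n; m≤n+m)
open import Data.Nat.Tactic.RingSolver using (solve-∀)
open import Algebra.Properties.CommutativeSemigroup +-commutativeSemigroup using (x∙yz≈y∙xz)
open import Algebra.Properties.CommutativeMonoid.Sum +-0-commutativeMonoid using (sum; sum-cong-≗; ∑-distrib-+; sum-replicate-zero)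
open import Data.Nat.Divisibility using (_∣_; _∣0; ∣-refl; ∣1⇒≡1; ∣m∣n⇒∣m+n; ∣m+n∣m⇒∣n)
open import Data.Fin as F using (Fin; _≟_; punchOut; _↑ˡ_; _↑ʳ_; splitAt)
open import Data.Fin.Permutation.Components using (transpose; transpose-inverse)
open import Data.Fin.Properties as Fin using (punchOut-injective; ↑ˡ-injective; ↑ʳ-injective; splitAt-↑ˡ; splitAt-↑ʳ; splitAt⁻¹-↑ˡ; splitAt⁻¹-↑ʳ; any?; all?; ¬∀⟶∃¬)
open import Data.Bool as Bool using (Bool; true; false; not; _∧_; _∨_; if_then_else_)
open import Data.Bool.Properties using (∨-zeroʳ; not-involutive)
open import Data.Product using (Σ; _×_; _,_; proj₁; proj₂)
open import Data.Sum as Sum using (_⊎_; inj₁; inj₂)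
open import Data.Empty using (⊥; ⊥-elim)
open import Data.Product.Properties using (≡-dec)
open import Relation.Binary.PropositionalEquality
open import Relation.Binary.Construct.Closure.ReflexiveTransitive using (Star; ε; _◅_; _◅◅_; gmap; reverse)
open import Relation.Nullary using (¬_; Dec; yes; no; does)
open import Relation.Nullary.Decidable using (dec-true; dec-false; _×-dec_; _⊎-dec_; ¬?)
open import Function using (_∘_; case_of_)

true≢false : true ≢ false
true≢false ()

∨-true⁻ : ∀ {a b} → a ∨ b ≡ true → a ≡ true ⊎ b ≡ true
∨-true⁻ {true}  _ = inj₁ refl
∨-true⁻ {false} h = inj₂ h

∧-true⁻ : ∀ {a b} → a ∧ b ≡ true → a ≡ true × b ≡ true
∧-true⁻ {true} {true} _ = refl , refl

does-true⁻ : ∀ {A : Set} {a? : Dec A} → does a? ≡ true → A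
does-true⁻ {a? = yes a} _ = a

not-does-true⁻ : ∀ {A : Set} {a? : Dec A} → not (does a?) ≡ true → ¬ A
not-does-true⁻ {a? = no ¬a} _ = ¬a

xor-true⁻ : ∀ {a b} → a Bool.xor b ≡ true → a ≢ b
xor-true⁻ {true}  {false} _ ()
xor-true⁻ {false} {true}  _ ()

ConstantOn : ∀ {A : Set} → (A → Bool) → (A → Bool) → Bool → Set
ConstantOn S M b = ∀ x → S x ≡ true → M x ≡ b

constantOn : ∀ {A : Set} {S M : A → Bool} → (ConstantOn S M false ⊎ ConstantOn S M true) → Σ Bool (ConstantOn S M)
constantOn (inj₁ h) = false , h
constantOn (inj₂ h) = true , h

constantOn⁻ : ∀ {A : Set} {S M : A → Bool} → Σ Bool (ConstantOn S M) → ConstantOn S M false ⊎ ConstantOn S M true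
constantOn⁻ (false , h) = inj₁ h
constantOn⁻ (true , h)  = inj₂ h

-- Counting and summing over Fin k

count-true : ∀ k → count (λ (_ : Fin k) → true) ≡ k
count-true zero    = refl
count-true (suc k) = cong suc (count-true k)

count≤size : ∀ {k} (P : Fin k → Bool) → count P ≤ k
count≤size {zero}  P = z≤n
count≤size {suc k} P with P F.zero
... | true  = s≤s (count≤size (P ∘ F.suc))
... | false = ≤-trans (count≤size (P ∘ F.suc)) (n≤1+n k)

_⊆ᵇ_ : ∀ {k} → (Fin k → Bool) → (Fin k → Bool) → Set
P ⊆ᵇ Q = ∀ i → P i ≡ true → Q i ≡ true

count-mono : ∀ {k} {P Q : Fin k → Bool} → P ⊆ᵇ Q → count P ≤ count Q
count-mono {zero}          P⊆Q = z≤n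
count-mono {suc k} {P} {Q} P⊆Q with P F.zero in p₀ | Q F.zero in q₀
... | true  | true  = s≤s (count-mono (P⊆Q ∘ F.suc))
... | true  | false = ⊥-elim (true≢false (trans (sym (P⊆Q F.zero p₀)) q₀))
... | false | true  = ≤-trans (count-mono (P⊆Q ∘ F.suc)) (n≤1+n _)
... | false | false = count-mono (P⊆Q ∘ F.suc)

count-strictMono : ∀ {k} {P Q : Fin k → Bool} → P ⊆ᵇ Q →
  ∀ v → Q v ≡ true → P v ≡ false → suc (count P) ≤ count Q
count-strictMono {suc k} {P} {Q} P⊆Q F.zero qv pv rewrite qv | pv = s≤s (count-mono (P⊆Q ∘ F.suc))
count-strictMono {suc k} {P} {Q} P⊆Q (F.suc v) qv pv with P F.zero in p₀ | Q F.zero in q₀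
... | true  | true  = s≤s (count-strictMono (P⊆Q ∘ F.suc) v qv pv)
... | true  | false = ⊥-elim (true≢false (trans (sym (P⊆Q F.zero p₀)) q₀))
... | false | true  = ≤-trans (count-strictMono (P⊆Q ∘ F.suc) v qv pv) (n≤1+n _)
... | false | false = count-strictMono (P⊆Q ∘ F.suc) v qv pv

count-suc⇒nonempty : ∀ {k} (P : Fin k → Bool) {c} → count P ≡ suc c → Σ (Fin k) λ i → P i ≡ true
count-suc⇒nonempty {suc k} P eq with P F.zero in p₀
... | true  = F.zero , p₀
... | false = let i , pi = count-suc⇒nonempty (P ∘ F.suc) eq in F.suc i , pi

without : ∀ {k} → (Fin k → Bool) → Fin k → Fin k → Bool
without P v u = if does (u ≟ v) then false else P u

without-true⁻ : ∀ {k} (P : Fin k → Bool) v u → without P v u ≡ true → P u ≡ true × u ≢ v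
without-true⁻ P v u h with u ≟ v
... | no u≢v = h , u≢v

without-true : ∀ {k} (P : Fin k → Bool) {v u} → P u ≡ true → u ≢ v → without P v u ≡ true
without-true P {v} {u} pu u≢v rewrite dec-false (u ≟ v) u≢v = pu

count-without : ∀ {k} (P : Fin k → Bool) v → P v ≡ true → count P ≡ suc (count (without P v))
count-without {suc k} P F.zero pv rewrite pv = refl
count-without {suc k} P (F.suc v) pv with P F.zero
... | true  = cong suc (count-without (P ∘ F.suc) v pv)
... | false = count-without (P ∘ F.suc) v pv

record IsPairing {k} (σ : Fin k → Fin k) (P : Fin k → Bool) : Set where
  field
    closed       : ∀ v → P v ≡ true → P (σ v) ≡ true
    fixpointFree : ∀ v → P v ≡ true → σ v ≢ v
    involutive   : ∀ v → P v ≡ true → σ (σ v) ≡ v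

module _ {k} {σ : Fin k → Fin k} {P : Fin k → Bool} (pairing : IsPairing σ P) {v} (pv : P v ≡ true) where
  open IsPairing pairing

  withoutPair : Fin k → Bool
  withoutPair = without (without P v) (σ v)

  count-withoutPair : count P ≡ suc (suc (count withoutPair))
  count-withoutPair = trans (count-without P v pv)
    (cong suc (count-without (without P v) (σ v) (without-true P (closed v pv) (fixpointFree v pv))))

  withoutPair⁻ : ∀ u → withoutPair u ≡ true → P u ≡ true × u ≢ v × u ≢ σ v
  withoutPair⁻ u h = let p , u≢σv = without-true⁻ (without P v) (σ v) u h ; pu , u≢v = without-true⁻ P v u p in
    pu , u≢v , u≢σv

  withoutPair-isPairing : IsPairing σ withoutPair
  withoutPair-isPairing = record
    { closed       = λ u h → let pu , u≢v , u≢σv = withoutPair⁻ u h in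
        without-true (without P v) (without-true P (closed u pu)
          (λ σu≡v → u≢σv (trans (sym (involutive u pu)) (cong σ σu≡v))))
          (λ σu≡σv → u≢v (trans (sym (involutive u pu)) (trans (cong σ σu≡σv) (involutive v pv))))
    ; fixpointFree = λ u h → fixpointFree u (proj₁ (withoutPair⁻ u h))
    ; involutive   = λ u h → involutive u (proj₁ (withoutPair⁻ u h))
    }

pairing⇒even : ∀ {k} {σ : Fin k → Fin k} {P : Fin k → Bool} → IsPairing σ P → 2 ∣ count P
pairing⇒even {k} {σ} {P} pairing = go (count P) P pairing refl
  where
    go : ∀ c (Q : Fin k → Bool) → IsPairing σ Q → count Q ≡ c → 2 ∣ c
    go zero Q _ _ = 2 ∣0
    go (suc c) Q pr eq with count-suc⇒nonempty Q eq
    go (suc zero)     Q pr eq | v , qv with () ← trans (sym eq) (count-withoutPair pr qv)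
    go (suc (suc c))  Q pr eq | v , qv = ∣m∣n⇒∣m+n ∣-refl
      (go c _ (withoutPair-isPairing pr qv) (suc-injective (suc-injective (trans (sym (count-withoutPair pr qv)) eq))))

count≤-injectiveOn : ∀ {k j} (P : Fin k → Bool) (c : ∀ a → P a ≡ true → Fin j) →
  (∀ a b pa pb → c a pa ≡ c b pb → a ≡ b) → count P ≤ j
count≤-injectiveOn {zero}  P c c-inj = z≤n
count≤-injectiveOn {suc k} P c c-inj with P F.zero in p₀
... | false = count≤-injectiveOn (P ∘ F.suc) (c ∘ F.suc) (λ a b pa pb eq → Fin.suc-injective (c-inj _ _ pa pb eq))
... | true  = avoiding _ (c F.zero p₀) (c ∘ F.suc) (λ a pa eq → 0≢suc (c-inj _ _ p₀ pa (sym eq)))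
                (λ a b pa pb eq → Fin.suc-injective (c-inj _ _ pa pb eq))
  where
    0≢suc : ∀ {a : Fin k} → F.zero ≢ F.suc a
    0≢suc ()
    avoiding : ∀ j (c₀ : Fin j) (c′ : ∀ a → P (F.suc a) ≡ true → Fin j) → (∀ a pa → c′ a pa ≢ c₀) →
      (∀ a b pa pb → c′ a pa ≡ c′ b pb → a ≡ b) → suc (count (P ∘ F.suc)) ≤ j
    avoiding (suc j) c₀ c′ c′≢c₀ c′-inj = s≤s (count≤-injectiveOn (P ∘ F.suc)
      (λ a pa → punchOut (c′≢c₀ a pa ∘ sym))
      (λ a b pa pb eq → c′-inj a b pa pb (punchOut-injective (c′≢c₀ a pa ∘ sym) (c′≢c₀ b pb ∘ sym) eq)))

count-∨ : ∀ {k} (P Q : Fin k → Bool) → (∀ i → P i ∧ Q i ≡ false) → count (λ i → P i ∨ Q i) ≡ count P + count Q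
count-∨ {zero}  P Q disjoint = refl
count-∨ {suc k} P Q disjoint with P F.zero | Q F.zero | disjoint F.zero
... | true  | false | _ = cong suc (count-∨ (P ∘ F.suc) (Q ∘ F.suc) (disjoint ∘ F.suc))
... | false | true  | _ = trans (cong suc (count-∨ (P ∘ F.suc) (Q ∘ F.suc) (disjoint ∘ F.suc))) (sym (+-suc _ _))
... | false | false | _ = count-∨ (P ∘ F.suc) (Q ∘ F.suc) (disjoint ∘ F.suc)

indicator : Bool → ℕ
indicator b = if b then 1 else 0

count-sum : ∀ {k} (P : Fin k → Bool) → count P ≡ sum (indicator ∘ P)
count-sum {zero}  P = refl
count-sum {suc k} P = cong (indicator (P F.zero) +_) (count-sum (P ∘ F.suc))

sum-↑ : ∀ k l (f : Fin (k + l) → ℕ) → sum f ≡ sum (λ i → f (i ↑ˡ l)) + sum (λ j → f (k ↑ʳ j))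
sum-↑ zero    l f = refl
sum-↑ (suc k) l f = trans (cong (f F.zero +_) (sum-↑ k l (f ∘ F.suc))) (sym (+-assoc (f F.zero) _ _))

↑-split : ∀ k l (i : Fin (k + l)) → (Σ (Fin k) λ a → a ↑ˡ l ≡ i) ⊎ (Σ (Fin l) λ b → k ↑ʳ b ≡ i)
↑-split k l i with splitAt k i in eq
... | inj₁ a = inj₁ (a , splitAt⁻¹-↑ˡ eq)
... | inj₂ b = inj₂ (b , splitAt⁻¹-↑ʳ eq)

↑ˡ≢↑ʳ : ∀ k l {a : Fin k} {b : Fin l} → a ↑ˡ l ≢ k ↑ʳ b
↑ˡ≢↑ʳ k l {a} {b} eq with () ← trans (sym (splitAt-↑ˡ k a l)) (trans (cong (splitAt k) eq) (splitAt-↑ʳ k l b))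

except : ∀ {k} → Fin k → (Fin k → ℕ) → Fin k → ℕ
except i f j = if does (j ≟ i) then 0 else f j

sum-except : ∀ {k} (i : Fin k) (f : Fin k → ℕ) → sum f ≡ f i + sum (except i f)
sum-except F.zero    f = refl
sum-except (F.suc i) f = trans (cong (f F.zero +_) (sum-except i (f ∘ F.suc)))
  (x∙yz≈y∙xz (f F.zero) (f (F.suc i)) _)

-- Graphs and perfect matchings

NonLoop : (G : Graph) → Edge G → Set
NonLoop G e = proj₁ (ends G e) ≢ proj₂ (ends G e)

module Properties (G : Graph) where

  Joins-sym : ∀ {e u v} → Joins G e u v → Joins G e v u
  Joins-sym (inj₁ p) = inj₂ p
  Joins-sym (inj₂ p) = inj₁ p

  Joins⇒Inc₁ : ∀ {e u v} → Joins G e u v → Inc G u e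
  Joins⇒Inc₁ (inj₁ p) = inj₁ (cong proj₁ p)
  Joins⇒Inc₁ (inj₂ p) = inj₂ (cong proj₂ p)

  Joins⇒Inc₂ : ∀ {e u v} → Joins G e u v → Inc G v e
  Joins⇒Inc₂ = Joins⇒Inc₁ ∘ Joins-sym

  Joins⇒Inc : ∀ {e u v w} → Joins G e u v → w ≡ u ⊎ w ≡ v → Inc G w e
  Joins⇒Inc j (inj₁ refl) = Joins⇒Inc₁ j
  Joins⇒Inc j (inj₂ refl) = Joins⇒Inc₂ j

  Inc-Joins : ∀ {e u v w} → Joins G e u v → Inc G w e → w ≡ u ⊎ w ≡ v
  Inc-Joins (inj₁ p) (inj₁ q) = inj₁ (trans (sym q) (cong proj₁ p))
  Inc-Joins (inj₁ p) (inj₂ q) = inj₂ (trans (sym q) (cong proj₂ p))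
  Inc-Joins (inj₂ p) (inj₁ q) = inj₂ (trans (sym q) (cong proj₁ p))
  Inc-Joins (inj₂ p) (inj₂ q) = inj₁ (trans (sym q) (cong proj₂ p))

  Inc⇒Joins : ∀ {e w} → Inc G w e → Σ (Vertex G) (Joins G e w)
  Inc⇒Joins {e} (inj₁ refl) = proj₂ (ends G e) , inj₁ refl
  Inc⇒Joins {e} (inj₂ refl) = proj₁ (ends G e) , inj₂ refl

  Joins-functional : ∀ {e w z z′} → Joins G e w z → Joins G e w z′ → z ≡ z′
  Joins-functional (inj₁ p) (inj₁ q) = cong proj₂ (trans (sym p) q)
  Joins-functional (inj₁ p) (inj₂ q) = trans (cong proj₂ (trans (sym p) q)) (cong proj₁ (trans (sym p) q))
  Joins-functional (inj₂ p) (inj₁ q) = trans (cong proj₁ (trans (sym p) q)) (cong proj₂ (trans (sym p) q))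
  Joins-functional (inj₂ p) (inj₂ q) = cong proj₁ (trans (sym p) q)

  NonLoop-Joins : ∀ {e u v} → NonLoop G e → Joins G e u v → u ≢ v
  NonLoop-Joins ne (inj₁ refl) = ne
  NonLoop-Joins ne (inj₂ refl) = ne ∘ sym

  Joins-distinct⇒NonLoop : ∀ {e u v} → Joins G e u v → u ≢ v → NonLoop G e
  Joins-distinct⇒NonLoop (inj₁ refl) u≢v = u≢v
  Joins-distinct⇒NonLoop (inj₂ refl) u≢v = u≢v ∘ sym

  matchingCovered⇒nonLoop : MatchingCovered G → ∀ e → NonLoop G e
  matchingCovered⇒nonLoop (_ , covered) e = let M , (nonLoop , _) , e∈M = covered e in nonLoop e e∈M

  module _ {M : EdgeSet G} (pm : PerfectMatching G M) where

    perfectMatching-unique : ∀ {a b v} → M a ≡ true → M b ≡ true → Inc G v a → Inc G v b → a ≡ b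
    perfectMatching-unique {a} {b} {v} a∈M b∈M v∈a v∈b =
      let _ , _ , _ , unique = proj₂ pm v in trans (unique a a∈M v∈a) (sym (unique b b∈M v∈b))

    matched : Vertex G → Edge G
    matched v = proj₁ (proj₂ pm v)

    matched∈M : ∀ v → M (matched v) ≡ true
    matched∈M v = proj₁ (proj₂ (proj₂ pm v))

    partner : Vertex G → Vertex G
    partner v = proj₁ (Inc⇒Joins (proj₁ (proj₂ (proj₂ (proj₂ pm v)))))

    matched-Joins : ∀ v → Joins G (matched v) v (partner v)
    matched-Joins v = proj₂ (Inc⇒Joins (proj₁ (proj₂ (proj₂ (proj₂ pm v)))))

    partner-unique : ∀ {a v w} → M a ≡ true → Joins G a v w → partner v ≡ w
    partner-unique a∈M j with perfectMatching-unique a∈M (matched∈M _) (Joins⇒Inc₁ j) (Joins⇒Inc₁ (matched-Joins _))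
    ... | refl = Joins-functional (matched-Joins _) j

    partner-isPairing : (P : Vertex G → Bool) → (∀ v → P v ≡ true → P (partner v) ≡ true) → IsPairing partner P
    partner-isPairing P closed = record
      { closed       = closed
      ; fixpointFree = λ v _ eq → NonLoop-Joins (proj₁ pm _ (matched∈M v)) (matched-Joins v) (sym eq)
      ; involutive   = λ v _ → partner-unique (matched∈M v) (Joins-sym (matched-Joins v))
      }

    perfectMatching⇒even : 2 ∣ n G
    perfectMatching⇒even = subst (2 ∣_) (count-true (n G)) (pairing⇒even (partner-isPairing _ λ _ _ → refl))

Star-crossing : ∀ {A : Set} {R : A → A → Set} (P : A → Bool) {a b} → Star R a b → P a ≡ true → P b ≡ false →
  Σ A λ u → Σ A λ w → P u ≡ true × P w ≡ false × R u w
Star-crossing P ε pa pb = ⊥-elim (true≢false (trans (sym pa) pb))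
Star-crossing P {a} (_◅_ {j = c} r path) pa pb with P c in pc
... | true  = Star-crossing P path pc pb
... | false = a , c , pa , pc , r

-- The image under f of a path, cut off at the first step that has no image; such steps start at
-- a Good vertex.
Star-mapUntil : ∀ {A B : Set} {R : A → A → Set} {T : B → B → Set} (f : A → B) (Good : A → Set) →
  (∀ {u v} → R u v → T (f u) (f v) ⊎ Good u) →
  ∀ {u t} → Star R u t → Good t → Σ A λ s → Good s × Star T (f u) (f s)
Star-mapUntil f Good step ε t-good = _ , t-good , ε
Star-mapUntil f Good step {u} (r ◅ path) t-good with step r
... | inj₂ u-good = u , u-good , ε
... | inj₁ r′ = let s , s-good , path′ = Star-mapUntil f Good step path t-good in s , s-good , r′ ◅ path′

∈Pair : ∀ {k} → Fin k → Fin k → Fin k → Bool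
∈Pair x y v = does (v ≟ x) ∨ does (v ≟ y)

∈Pair-true⁻ : ∀ {k} {x y v : Fin k} → ∈Pair x y v ≡ true → v ≡ x ⊎ v ≡ y
∈Pair-true⁻ {x = x} {y} {v} h with v ≟ x | v ≟ y
... | yes v≡x | _       = inj₁ v≡x
... | no _    | yes v≡y = inj₂ v≡y

∈Pair-false⁻ : ∀ {k} {x y v : Fin k} → ∈Pair x y v ≡ false → v ≢ x × v ≢ y
∈Pair-false⁻ {x = x} {y} {v} h with v ≟ x | v ≟ y
... | no v≢x | no v≢y = v≢x , v≢y

∃-other : ∀ {k} (e : Fin k) → 2 ≤ k → Σ (Fin k) λ b → b ≢ e
∃-other F.zero    (s≤s (s≤s _)) = F.suc F.zero , λ ()
∃-other (F.suc e) (s≤s (s≤s _)) = F.zero , λ ()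

module _ (H : Graph) {e x y} (e=xy : Joins H e x y) where
  open Properties H

  private
    x∈xy : ∈Pair x y x ≡ true
    x∈xy rewrite dec-true (x ≟ x) refl = refl

    matchedWith-outside : ∀ {M} → PerfectMatching H M → M e ≡ true → ∀ {b} → M b ≡ true → b ≢ e →
      ∈Pair x y (proj₁ (ends H b)) ≡ false
    matchedWith-outside pm e∈M {b} b∈M b≢e with ∈Pair x y (proj₁ (ends H b)) in eq
    ... | false = refl
    ... | true  = ⊥-elim (b≢e (perfectMatching-unique pm b∈M e∈M (inj₁ refl) (Joins⇒Inc e=xy (∈Pair-true⁻ eq))))

    leaving-avoids : ∀ {M g u w} → PerfectMatching H M → M g ≡ true → Joins H g u w →
      ∈Pair x y u ≡ true → ∈Pair x y w ≡ false → M e ≡ false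
    leaving-avoids {M} {g} {u} {w} pm g∈M g=uw u∈xy w∉xy with M e in e∈M
    ... | false = refl
    ... | true with perfectMatching-unique pm g∈M e∈M (Joins⇒Inc₁ g=uw) (Joins⇒Inc e=xy (∈Pair-true⁻ {v = u} u∈xy))
    ...   | refl with Inc-Joins e=xy (Joins⇒Inc₂ g=uw) | ∈Pair-false⁻ {v = w} w∉xy
    ...     | inj₁ w≡x | w≢x , _ = ⊥-elim (w≢x w≡x)
    ...     | inj₂ w≡y | _ , w≢y = ⊥-elim (w≢y w≡y)

  perfectMatching-avoiding : MatchingCovered H → 2 ≤ m H → Σ (EdgeSet H) λ M → PerfectMatching H M × M e ≡ false
  perfectMatching-avoiding (connected , covered) 2≤m with ∃-other e 2≤m
  ... | b , b≢e with covered b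
  ... | M , pm , b∈M with M e in e∈M
  ...   | false = M , pm , e∈M
  ...   | true with Star-crossing (∈Pair x y) (connected x (proj₁ (ends H b))) x∈xy (matchedWith-outside pm e∈M b∈M b≢e)
  ...     | u , w , u∈xy , w∉xy , g , g=uw =
    let M′ , pm′ , g∈M′ = covered g in M′ , pm′ , leaving-avoids pm′ g∈M′ g=uw u∈xy w∉xy

module Reachability {k} {R : Fin k → Fin k → Set} (R? : ∀ u v → Dec (R u v)) (x : Fin k) where

  reach : ℕ → Fin k → Bool
  reach zero    v = does (v ≟ x)
  reach (suc j) v = reach j v ∨ does (any? λ u → (reach j u Bool.≟ true) ×-dec R? u v)

  reach-sound : ∀ j v → reach j v ≡ true → Star R x v
  reach-sound zero    v h with refl ← does-true⁻ {a? = v ≟ x} h = ε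
  reach-sound (suc j) v h with ∨-true⁻ {reach j v} h
  ... | inj₁ h′ = reach-sound j v h′
  ... | inj₂ h′ = let u , u∈ , r = does-true⁻ {a? = any? (λ u → (reach j u Bool.≟ true) ×-dec R? u v)} h′ in
    reach-sound j u u∈ ◅◅ (r ◅ ε)

  reach-mono : ∀ j → reach j ⊆ᵇ reach (suc j)
  reach-mono j v h rewrite h = refl

  x∈reach : ∀ j → reach j x ≡ true
  x∈reach zero    = dec-true (x ≟ x) refl
  x∈reach (suc j) = reach-mono j x (x∈reach j)

  Stable : ℕ → Set
  Stable j = ∀ v → reach (suc j) v ≡ reach j v

  stable-closed : ∀ {j} → Stable j → ∀ {u v} → reach j u ≡ true → R u v → reach j v ≡ true
  stable-closed {j} stable {u} {v} u∈ r =
    trans (sym (stable v)) (∨-zeroʳ′ (reach j v) (dec-true (any? _) (u , u∈ , r)))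
    where
      ∨-zeroʳ′ : ∀ a {b} → b ≡ true → a ∨ b ≡ true
      ∨-zeroʳ′ a refl = ∨-zeroʳ a

  stabilises-or-grows : ∀ j → Σ ℕ Stable ⊎ j < count (reach j)
  stabilises-or-grows zero = inj₂ (subst (0 <_) (sym (count-without (reach 0) x (x∈reach 0))) (s≤s z≤n))
  stabilises-or-grows (suc j) with stabilises-or-grows j
  ... | inj₁ stable = inj₁ stable
  ... | inj₂ j<count with all? (λ v → reach (suc j) v Bool.≟ reach j v)
  ...   | yes stable = inj₁ (j , stable)
  ...   | no unstable with ¬∀⟶∃¬ k _ (λ v → reach (suc j) v Bool.≟ reach j v) unstable
  ...     | v , differ = let new , old = strict-increase (reach-mono j v) differ in
    inj₂ (≤-trans (s≤s j<count) (count-strictMono (reach-mono j) v new old))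
    where
      strict-increase : ∀ {a b} → (a ≡ true → b ≡ true) → b ≢ a → b ≡ true × a ≡ false
      strict-increase {false} {false} _ b≢a = ⊥-elim (b≢a refl)
      strict-increase {false} {true}  _ _   = refl , refl
      strict-increase {true}          a⇒b b≢a = ⊥-elim (b≢a (a⇒b refl))

  stabilises : Σ ℕ Stable
  stabilises with stabilises-or-grows k
  ... | inj₁ stable = stable
  ... | inj₂ k<count = ⊥-elim (n≮n k (<-≤-trans k<count (count≤size (reach k))))

  reachable? : ∀ v → Dec (Star R x v)
  reachable? v with stabilises
  ... | j , stable with reach j v in v∈
  ...   | true  = yes (reach-sound j v v∈)
  ...   | false = no λ path → true≢false (trans (sym (closure (x∈reach j) path)) v∈)
    where
      closure : ∀ {u w} → reach j u ≡ true → Star R u w → reach j w ≡ true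
      closure u∈ ε          = u∈
      closure u∈ (r ◅ path) = closure (stable-closed {j} stable u∈ r) path

2∤-consecutive : ∀ {c} → 2 ∣ c → 2 ∣ suc c → ⊥
2∤-consecutive {c} 2∣c 2∣1+c with () ← ∣1⇒≡1 (∣m+n∣m⇒∣n (subst (2 ∣_) (+-comm 1 c) 2∣1+c) 2∣c)

AdjExcept : (G : Graph) → Edge G → Vertex G → Vertex G → Set
AdjExcept G e u v = Σ (Edge G) λ a → a ≢ e × Joins G a u v

AdjExcept? : (G : Graph) (e : Edge G) → ∀ u v → Dec (AdjExcept G e u v)
AdjExcept? G e u v = any? λ a → ¬? (a ≟ e) ×-dec (≡-dec _≟_ _≟_ (ends G a) (u , v) ⊎-dec ≡-dec _≟_ _≟_ (ends G a) (v , u))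

module _ (H : Graph) (mc : MatchingCovered H) (2≤m : 2 ≤ m H) {e x y} (e=xy : Joins H e x y) where
  open Properties H
  open Reachability (AdjExcept? H e) x using (reachable?)

  -- Otherwise the component C of x in H - e misses y, and C is evenly covered both by a
  -- perfect matching avoiding e and, after removing x, by one containing e.
  matchingCovered⇒bridgeless : Star (AdjExcept H e) x y
  matchingCovered⇒bridgeless with reachable? y
  ... | yes path = path
  ... | no  y∉C  = ⊥-elim (2∤-consecutive C-x-even (subst (2 ∣_) (count-without C x (dec-true (reachable? x) ε)) C-even))
    where
      C : Vertex H → Bool
      C v = does (reachable? v)
      C-closed : ∀ {a u v} → a ≢ e → Joins H a u v → C u ≡ true → C v ≡ true
      C-closed {a} {u} {v} a≢e a=uv u∈C = dec-true (reachable? v) (does-true⁻ {a? = reachable? u} u∈C ◅◅ ((a , a≢e , a=uv) ◅ ε))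
      C-even : 2 ∣ count C
      C-even = let M , pm , e∉M = perfectMatching-avoiding H e=xy mc 2≤m in
        pairing⇒even (partner-isPairing pm C λ v v∈C →
          C-closed (λ eq → true≢false (trans (sym (matched∈M pm v)) (trans (cong M eq) e∉M))) (matched-Joins pm v) v∈C)
      partner-stays : ∀ {M} (pm : PerfectMatching H M) → M e ≡ true → ∀ {v} → C v ≡ true → v ≢ x →
        without C x (partner pm v) ≡ true
      partner-stays pm e∈M {v} v∈C v≢x with matched pm v ≟ e
      ... | yes matched≡e with Inc-Joins e=xy (subst (Inc H v) matched≡e (Joins⇒Inc₁ (matched-Joins pm v)))
      ...   | inj₁ v≡x  = ⊥-elim (v≢x v≡x)
      ...   | inj₂ refl = ⊥-elim (y∉C (does-true⁻ {a? = reachable? v} v∈C))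
      partner-stays pm e∈M {v} v∈C v≢x | no matched≢e =
        without-true C (C-closed matched≢e (matched-Joins pm v) v∈C) λ partner≡x →
          matched≢e (perfectMatching-unique pm (matched∈M pm v) e∈M
            (subst (λ w → Inc H w (matched pm v)) partner≡x (Joins⇒Inc₂ (matched-Joins pm v))) (Joins⇒Inc₁ e=xy))
      C-x-even : 2 ∣ count (without C x)
      C-x-even = let M , pm , e∈M = proj₂ mc e in
        pairing⇒even (partner-isPairing pm (without C x) λ v h →
          let v∈C , v≢x = without-true⁻ C x v h in partner-stays pm e∈M v∈C v≢x)

endsAt : (H : Graph) → Vertex H → Edge H → ℕ
endsAt H w a = indicator (does (proj₁ (ends H a) ≟ w)) + indicator (does (proj₂ (ends H a) ≟ w))

degree-sum : ∀ H w → degree H w ≡ sum (endsAt H w)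
degree-sum H w = trans (cong₂ _+_ (count-sum first) (count-sum second)) (sym (∑-distrib-+ (indicator ∘ first) (indicator ∘ second)))
  where
    first second : Edge H → Bool
    first  a = does (proj₁ (ends H a) ≟ w)
    second a = does (proj₂ (ends H a) ≟ w)

endsAt-Joins : ∀ H {a u z} w → Joins H a u z → endsAt H w a ≡ indicator (does (u ≟ w)) + indicator (does (z ≟ w))
endsAt-Joins H w (inj₁ refl) = refl
endsAt-Joins H {a} w (inj₂ refl) = +-comm (indicator (does (proj₁ (ends H a) ≟ w))) _

except-cong : ∀ {k} {i : Fin k} {f g : Fin k → ℕ} → (∀ j → j ≢ i → f j ≡ g j) → ∀ j → except i f j ≡ except i g j
except-cong {i = i} f≗g j with j ≟ i
... | yes _   = refl
... | no  j≢i = f≗g j j≢i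

sum-except-zero : ∀ {k} {i : Fin k} {f : Fin k → ℕ} → (∀ j → j ≢ i → f j ≡ 0) → sum (except i f) ≡ 0
sum-except-zero {k} {i} {f} f≗0 = trans (sum-cong-≗ except≗0) (sum-replicate-zero k)
  where
    except≗0 : ∀ j → except i f j ≡ 0
    except≗0 j with j ≟ i
    ... | yes _   = refl
    ... | no  j≢i = f≗0 j j≢i

proper⇒degree≤ : (H : Graph) → (∀ a → NonLoop H a) → ∀ {k} {c : Edge H → Fin k} →
  ProperEdgeColouring H k c → ∀ w → degree H w ≤ k
proper⇒degree≤ H nonLoop {k} {c} proper w =
  subst (_≤ k) (count-∨ first second disjoint) (count≤-injectiveOn (λ a → first a ∨ second a) (λ a _ → c a) injective)
  where
    first second : Edge H → Bool
    first  a = does (proj₁ (ends H a) ≟ w)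
    second a = does (proj₂ (ends H a) ≟ w)
    disjoint : ∀ a → first a ∧ second a ≡ false
    disjoint a with proj₁ (ends H a) ≟ w | proj₂ (ends H a) ≟ w
    ... | yes p | yes q = ⊥-elim (nonLoop a (trans p (sym q)))
    ... | yes _ | no _  = refl
    ... | no _  | _     = refl
    incident : ∀ a → first a ∨ second a ≡ true → Inc H w a
    incident a h with ∨-true⁻ {first a} h
    ... | inj₁ p = inj₁ (does-true⁻ {a? = proj₁ (ends H a) ≟ w} p)
    ... | inj₂ q = inj₂ (does-true⁻ {a? = proj₂ (ends H a) ≟ w} q)
    injective : ∀ a b pa pb → c a ≡ c b → a ≡ b
    injective a b pa pb ca≡cb with a ≟ b
    ... | yes a≡b = a≡b
    ... | no  a≢b = ⊥-elim (proper a b a≢b (w , incident a pa , incident b pb) ca≡cb)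

maxOver-const : ∀ {k} (f : Fin k → ℕ) {r} → Fin k → (∀ i → f i ≡ r) → maxOver f ≡ r
maxOver-const {suc zero}    f {r} _ f≗r = trans (cong (_⊔ 0) (f≗r F.zero)) (⊔-identityʳ r)
maxOver-const {suc (suc k)} f {r} _ f≗r =
  trans (cong₂ _⊔_ (f≗r F.zero) (maxOver-const (f ∘ F.suc) F.zero (f≗r ∘ F.suc))) (⊔-idem r)

regular-maxDegree : ∀ H {r} → Vertex H → Regular H r → maxDegree H ≡ r
regular-maxDegree H v = maxOver-const (degree H) v

transpose-injective : ∀ {k} (i j : Fin k) {a b} → transpose i j a ≡ transpose i j b → a ≡ b
transpose-injective i j {a} {b} eq =
  trans (sym (transpose-inverse j i)) (trans (cong (transpose j i) eq) (transpose-inverse j i))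

transpose-matchˡ : ∀ {k} (i j : Fin k) → transpose i j i ≡ j
transpose-matchˡ i j rewrite dec-true (i ≟ i) refl = refl

-- The glued graph

-- Everything the proof uses about `glue`.  Since `Gluing-swap` exchanges the roles of G₁ and G₂,
-- each one-sided lemma below is proved for the left side only.
record Gluing (G₁ G₂ G : Graph) (e₁ : Edge G₁) (e₂ : Edge G₂) (x₁ y₁ : Vertex G₁) (x₂ y₂ : Vertex G₂) : Set where
  field
    VL : Vertex G₁ → Vertex G
    VR : Vertex G₂ → Vertex G
    EL : Edge G₁ → Edge G
    ER : Edge G₂ → Edge G
    VL-injective : ∀ {u v} → VL u ≡ VL v → u ≡ v
    VR-injective : ∀ {u v} → VR u ≡ VR v → u ≡ v
    VL≢VR        : ∀ {u v} → VL u ≢ VR v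
    EL-injective : ∀ {a b} → EL a ≡ EL b → a ≡ b
    ER-injective : ∀ {a b} → ER a ≡ ER b → a ≡ b
    EL≢ER        : ∀ {a b} → EL a ≢ ER b
    vertex-split : (w : Vertex G) → (Σ (Vertex G₁) λ u → VL u ≡ w) ⊎ (Σ (Vertex G₂) λ v → VR v ≡ w)
    edge-split   : (g : Edge G) → (Σ (Edge G₁) λ a → EL a ≡ g) ⊎ (Σ (Edge G₂) λ b → ER b ≡ g)
    EL-ends      : ∀ a → a ≢ e₁ → ends G (EL a) ≡ (VL (proj₁ (ends G₁ a)) , VL (proj₂ (ends G₁ a)))
    ER-ends      : ∀ b → b ≢ e₂ → ends G (ER b) ≡ (VR (proj₁ (ends G₂ b)) , VR (proj₂ (ends G₂ b)))
    f₁-joins     : Joins G (EL e₁) (VL x₁) (VR x₂)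
    f₂-joins     : Joins G (ER e₂) (VL y₁) (VR y₂)
    e₁-joins     : Joins G₁ e₁ x₁ y₁
    e₂-joins     : Joins G₂ e₂ x₂ y₂
    mc₁          : MatchingCovered G₁
    mc₂          : MatchingCovered G₂
    2≤m₁         : 2 ≤ m G₁
    2≤m₂         : 2 ≤ m G₂
    sum-split    : (f : Edge G → ℕ) → sum f ≡ sum (f ∘ EL) + sum (f ∘ ER)
    n₁≤n         : n G₁ ≤ n G
    n₂≤n         : n G₂ ≤ n G

Gluing-swap : ∀ {G₁ G₂ G e₁ e₂ x₁ y₁ x₂ y₂} → Gluing G₁ G₂ G e₁ e₂ x₁ y₁ x₂ y₂ → Gluing G₂ G₁ G e₂ e₁ y₂ x₂ y₁ x₁
Gluing-swap {G₁} {G₂} {G} gl = record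
  { VL = VR ; VR = VL ; EL = ER ; ER = EL
  ; VL-injective = VR-injective ; VR-injective = VL-injective ; VL≢VR = VL≢VR ∘ sym
  ; EL-injective = ER-injective ; ER-injective = EL-injective ; EL≢ER = EL≢ER ∘ sym
  ; vertex-split = Sum.swap ∘ vertex-split ; edge-split = Sum.swap ∘ edge-split
  ; EL-ends = ER-ends ; ER-ends = EL-ends
  ; f₁-joins = Joins-sym G f₂-joins ; f₂-joins = Joins-sym G f₁-joins
  ; e₁-joins = Joins-sym G₂ e₂-joins ; e₂-joins = Joins-sym G₁ e₁-joins
  ; mc₁ = mc₂ ; mc₂ = mc₁ ; 2≤m₁ = 2≤m₂ ; 2≤m₂ = 2≤m₁
  ; sum-split = λ f → trans (sum-split f) (+-comm (sum (f ∘ EL)) _)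
  ; n₁≤n = n₂≤n ; n₂≤n = n₁≤n
  }
  where
    open Gluing gl
    open Properties using (Joins-sym)

module Side {G₁ G₂ G : Graph} {e₁ : Edge G₁} {e₂ : Edge G₂} {x₁ y₁ : Vertex G₁} {x₂ y₂ : Vertex G₂}
            (gl : Gluing G₁ G₂ G e₁ e₂ x₁ y₁ x₂ y₂) where
  open Gluing gl
  open Properties G
  private
    module L = Properties G₁

  x₁≢y₁ : x₁ ≢ y₁
  x₁≢y₁ = L.NonLoop-Joins (L.matchingCovered⇒nonLoop mc₁ e₁) e₁-joins

  EL-joins : ∀ {a u v} → a ≢ e₁ → Joins G₁ a u v → Joins G (EL a) (VL u) (VL v)
  EL-joins {a} a≢e₁ (inj₁ p) = inj₁ (trans (EL-ends a a≢e₁) (cong (λ (s , t) → VL s , VL t) p))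
  EL-joins {a} a≢e₁ (inj₂ p) = inj₂ (trans (EL-ends a a≢e₁) (cong (λ (s , t) → VL s , VL t) p))

  EL-Inc : ∀ {a u} → a ≢ e₁ → Inc G₁ u a → Inc G (VL u) (EL a)
  EL-Inc a≢e₁ u∈a = Joins⇒Inc₁ (EL-joins a≢e₁ (proj₂ (L.Inc⇒Joins u∈a)))

  EL-Inc⁻ : ∀ {a w} → a ≢ e₁ → Inc G w (EL a) → Σ (Vertex G₁) λ u → w ≡ VL u × Inc G₁ u a
  EL-Inc⁻ {a} a≢e₁ w∈a with Inc-Joins (EL-joins a≢e₁ (inj₁ refl)) w∈a
  ... | inj₁ p = _ , p , inj₁ refl
  ... | inj₂ p = _ , p , inj₂ refl

  EL-VL-Inc⁻ : ∀ {a u} → a ≢ e₁ → Inc G (VL u) (EL a) → Inc G₁ u a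
  EL-VL-Inc⁻ a≢e₁ u∈a with EL-Inc⁻ a≢e₁ u∈a
  ... | _ , p , u′∈a rewrite VL-injective p = u′∈a

  VL∉ER : ∀ {b u} → b ≢ e₂ → ¬ Inc G (VL u) (ER b)
  VL∉ER {b} b≢e₂ u∈b with Inc-Joins (inj₁ (ER-ends b b≢e₂)) u∈b
  ... | inj₁ p = VL≢VR p
  ... | inj₂ p = VL≢VR p

  f₁-VL-Inc⁻ : ∀ {u} → Inc G (VL u) (EL e₁) → u ≡ x₁
  f₁-VL-Inc⁻ u∈f₁ with Inc-Joins f₁-joins u∈f₁
  ... | inj₁ p = VL-injective p
  ... | inj₂ p = ⊥-elim (VL≢VR p)

  f₂-VL-Inc⁻ : ∀ {u} → Inc G (VL u) (ER e₂) → u ≡ y₁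
  f₂-VL-Inc⁻ u∈f₂ with Inc-Joins f₂-joins u∈f₂
  ... | inj₁ p = VL-injective p
  ... | inj₂ p = ⊥-elim (VL≢VR p)

  EL-nonLoop : ∀ a → NonLoop G (EL a)
  EL-nonLoop a with a ≟ e₁
  ... | yes refl = Joins-distinct⇒NonLoop f₁-joins VL≢VR
  ... | no a≢e₁ = λ loop → L.matchingCovered⇒nonLoop mc₁ a
          (VL-injective (trans (sym (cong proj₁ (EL-ends a a≢e₁))) (trans loop (cong proj₂ (EL-ends a a≢e₁)))))

  x₁y₁ : Vertex G₁ → Set
  x₁y₁ s = s ≡ x₁ ⊎ s ≡ y₁

  e₁-bypass : Star (AdjExcept G₁ e₁) y₁ x₁
  e₁-bypass = reverse (λ (a , a≢e₁ , j) → a , a≢e₁ , L.Joins-sym j) (matchingCovered⇒bridgeless G₁ mc₁ 2≤m₁ e₁-joins)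

  VL-bypass : ∀ {T : Vertex G → Vertex G → Set} → (∀ {a u v} → a ≢ e₁ → Joins G₁ a u v → T (VL u) (VL v)) →
    Star T (VL y₁) (VL x₁)
  VL-bypass step = gmap VL (λ (a , a≢e₁ , j) → step a≢e₁ j) e₁-bypass

  VL⇝VLx₁ : ∀ u → Star (Adj G) (VL u) (VL x₁)
  VL⇝VLx₁ u with Star-mapUntil VL x₁y₁ step (proj₁ mc₁ u x₁) (inj₁ refl)
    where
      step : ∀ {u v} → Adj G₁ u v → Adj G (VL u) (VL v) ⊎ x₁y₁ u
      step (a , j) with a ≟ e₁
      ... | yes refl = inj₂ (L.Inc-Joins e₁-joins (L.Joins⇒Inc₁ j))
      ... | no a≢e₁  = inj₁ (EL a , EL-joins a≢e₁ j)
  ... | _ , inj₁ refl , path = path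
  ... | _ , inj₂ refl , path = path ◅◅ VL-bypass λ a≢e₁ j → EL _ , EL-joins a≢e₁ j

  VL⇝x₁y₁-avoiding : (w : Vertex G) → (∀ u → VL u ≢ w) → ∀ u →
    Σ (Vertex G₁) λ s → x₁y₁ s × Star (AdjAvoiding G w) (VL u) (VL s)
  VL⇝x₁y₁-avoiding w w∉L u = Star-mapUntil VL x₁y₁ step (proj₁ mc₁ u x₁) (inj₁ refl)
    where
      step : ∀ {u v} → Adj G₁ u v → AdjAvoiding G w (VL u) (VL v) ⊎ x₁y₁ u
      step {u} {v} (a , j) with a ≟ e₁
      ... | yes refl = inj₂ (L.Inc-Joins e₁-joins (L.Joins⇒Inc₁ j))
      ... | no a≢e₁  = inj₁ ((EL a , EL-joins a≢e₁ j) , w∉L u , w∉L v)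

  VL⇝x₁y₁-avoiding-VL : TwoConnected G₁ → ∀ w₁ u → u ≢ w₁ →
    Σ (Vertex G₁) λ s → (x₁y₁ s × s ≢ w₁) × Star (AdjAvoiding G (VL w₁)) (VL u) (VL s)
  VL⇝x₁y₁-avoiding-VL (_ , _ , avoiding) w₁ u u≢w₁ =
    let t , t-good = target in Star-mapUntil VL Good step (avoiding w₁ u t u≢w₁ (proj₂ t-good)) t-good
    where
      Good : Vertex G₁ → Set
      Good s = x₁y₁ s × s ≢ w₁
      target : Σ (Vertex G₁) Good
      target with x₁ ≟ w₁
      ... | yes x₁≡w₁ = y₁ , inj₂ refl , λ y₁≡w₁ → x₁≢y₁ (trans x₁≡w₁ (sym y₁≡w₁))
      ... | no  x₁≢w₁ = x₁ , inj₁ refl , x₁≢w₁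
      step : ∀ {u v} → AdjAvoiding G₁ w₁ u v → AdjAvoiding G (VL w₁) (VL u) (VL v) ⊎ Good u
      step ((a , j) , u≢w₁ , v≢w₁) with a ≟ e₁
      ... | yes refl = inj₂ (L.Inc-Joins e₁-joins (L.Joins⇒Inc₁ j) , u≢w₁)
      ... | no a≢e₁  = inj₁ ((EL a , EL-joins a≢e₁ j) , u≢w₁ ∘ VL-injective , v≢w₁ ∘ VL-injective)

  VL-Inc-cases : ∀ {u g} → Inc G (VL u) g →
    (Σ (Edge G₁) λ a → g ≡ EL a × a ≢ e₁ × Inc G₁ u a) ⊎ (g ≡ EL e₁ × u ≡ x₁) ⊎ (g ≡ ER e₂ × u ≡ y₁)
  VL-Inc-cases {u} {g} u∈g with edge-split g
  ... | inj₁ (a , refl) with a ≟ e₁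
  ...   | no a≢e₁  = inj₁ (a , refl , a≢e₁ , EL-VL-Inc⁻ a≢e₁ u∈g)
  ...   | yes refl = inj₂ (inj₁ (refl , f₁-VL-Inc⁻ u∈g))
  VL-Inc-cases {u} {g} u∈g | inj₂ (b , refl) with b ≟ e₂
  ...   | no b≢e₂  = ⊥-elim (VL∉ER b≢e₂ u∈g)
  ...   | yes refl = inj₂ (inj₂ (refl , f₂-VL-Inc⁻ u∈g))

  combined-covers-VL : ∀ {M₁ M₂} → PerfectMatching G₁ M₁ → PerfectMatching G₂ M₂ → M₁ e₁ ≡ M₂ e₂ →
    (M : EdgeSet G) → (∀ a → M (EL a) ≡ M₁ a) → (∀ b → M (ER b) ≡ M₂ b) →
    ∀ u → Σ (Edge G) λ g → M g ≡ true × Inc G (VL u) g × (∀ g′ → M g′ ≡ true → Inc G (VL u) g′ → g′ ≡ g)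
  combined-covers-VL {M₁} {M₂} pm₁ pm₂ e₁∼e₂ M M-L M-R u with proj₂ pm₁ u
  ... | a , a∈M₁ , u∈a , unique with a ≟ e₁
  ... | no a≢e₁ = EL a , trans (M-L a) a∈M₁ , EL-Inc a≢e₁ u∈a , only
    where
      e₁∉M : M₁ e₁ ≡ true → Inc G₁ u e₁ → ⊥
      e₁∉M e₁∈M₁ u∈e₁ = a≢e₁ (sym (unique e₁ e₁∈M₁ u∈e₁))
      only : ∀ g′ → M g′ ≡ true → Inc G (VL u) g′ → g′ ≡ EL a
      only g′ g′∈M u∈g′ with VL-Inc-cases u∈g′
      ... | inj₁ (a′ , refl , _ , u∈a′)  = cong EL (unique a′ (trans (sym (M-L a′)) g′∈M) u∈a′)
      ... | inj₂ (inj₁ (refl , refl)) = ⊥-elim (e₁∉M (trans (sym (M-L e₁)) g′∈M) (L.Joins⇒Inc₁ e₁-joins))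
      ... | inj₂ (inj₂ (refl , refl)) = ⊥-elim (e₁∉M (trans e₁∼e₂ (trans (sym (M-R e₂)) g′∈M)) (L.Joins⇒Inc₂ e₁-joins))
  ... | yes refl = matched-f (L.Inc-Joins e₁-joins u∈a)
    where
      other-edges : ∀ {g′} → M g′ ≡ true → (Σ (Edge G₁) λ a′ → g′ ≡ EL a′ × a′ ≢ e₁ × Inc G₁ u a′) → ⊥
      other-edges g′∈M (a′ , refl , a′≢e₁ , u∈a′) = a′≢e₁ (unique a′ (trans (sym (M-L a′)) g′∈M) u∈a′)
      matched-f : u ≡ x₁ ⊎ u ≡ y₁ → Σ (Edge G) λ g → M g ≡ true × Inc G (VL u) g ×
                    (∀ g′ → M g′ ≡ true → Inc G (VL u) g′ → g′ ≡ g)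
      matched-f (inj₁ refl) = EL e₁ , trans (M-L e₁) a∈M₁ , Joins⇒Inc₁ f₁-joins , λ g′ g′∈M u∈g′ →
        case VL-Inc-cases u∈g′ of λ where
          (inj₁ other) → ⊥-elim (other-edges g′∈M other)
          (inj₂ (inj₁ (refl , _))) → refl
          (inj₂ (inj₂ (_ , x₁≡y₁))) → ⊥-elim (x₁≢y₁ x₁≡y₁)
      matched-f (inj₂ refl) = ER e₂ , trans (M-R e₂) (trans (sym e₁∼e₂) a∈M₁) , Joins⇒Inc₁ f₂-joins , λ g′ g′∈M u∈g′ →
        case VL-Inc-cases u∈g′ of λ where
          (inj₁ other) → ⊥-elim (other-edges g′∈M other)
          (inj₂ (inj₁ (_ , y₁≡x₁))) → ⊥-elim (x₁≢y₁ (sym y₁≡x₁))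
          (inj₂ (inj₂ (refl , _))) → refl

  fromVL : Vertex G₁ → Vertex G → Vertex G₁
  fromVL default w with vertex-split w
  ... | inj₁ (u , _) = u
  ... | inj₂ _       = default

  fromVL-VL : ∀ {default u w} → VL u ≡ w → fromVL default w ≡ u
  fromVL-VL {default} {u} {w} VLu≡w with vertex-split w
  ... | inj₁ (u′ , VLu′≡w) = VL-injective (trans VLu′≡w (sym VLu≡w))
  ... | inj₂ (v , VRv≡w)   = ⊥-elim (VL≢VR (trans VLu≡w (sym VRv≡w)))

  f₁∈M⇒f₂∈M : ∀ {M} → PerfectMatching G M → M (EL e₁) ≡ true → M (ER e₂) ≡ true
  f₁∈M⇒f₂∈M {M} pm f₁∈M with M (ER e₂) in f₂∉M
  ... | true  = refl
  ... | false = let _ , pm₁ , _ = proj₂ mc₁ e₁ in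
    ⊥-elim (2∤-consecutive (pairing⇒even σ₁-pairing) (subst (2 ∣_) n₁≡1+count (L.perfectMatching⇒even pm₁)))
    where
      n₁≡1+count : n G₁ ≡ suc (count (without (λ _ → true) x₁))
      n₁≡1+count = trans (sym (count-true (n G₁))) (count-without (λ _ → true) x₁ refl)
      VL-joins : ∀ u → Joins G (matched pm (VL u)) (VL u) (partner pm (VL u))
      VL-joins u = matched-Joins pm (VL u)
      partner-VL : ∀ u → u ≢ x₁ → Σ (Vertex G₁) λ u′ → partner pm (VL u) ≡ VL u′ × u′ ≢ x₁
      partner-VL u u≢x₁ with VL-Inc-cases (Joins⇒Inc₁ (VL-joins u))
      ... | inj₂ (inj₁ (_ , u≡x₁)) = ⊥-elim (u≢x₁ u≡x₁)
      ... | inj₂ (inj₂ (g≡f₂ , _)) = ⊥-elim (true≢false (trans (sym (matched∈M pm (VL u))) (trans (cong M g≡f₂) f₂∉M)))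
      ... | inj₁ (a , g≡EL-a , a≢e₁ , _) =
        let u′ , p , _ = EL-Inc⁻ a≢e₁ (subst (Inc G _) g≡EL-a (Joins⇒Inc₂ (VL-joins u))) in
        u′ , p , λ u′≡x₁ → a≢e₁ (EL-injective (trans (sym g≡EL-a)
          (perfectMatching-unique pm (matched∈M pm (VL u)) f₁∈M
            (subst (λ w → Inc G w _) (trans p (cong VL u′≡x₁)) (Joins⇒Inc₂ (VL-joins u))) (Joins⇒Inc₁ f₁-joins))))
      σ₁ : Vertex G₁ → Vertex G₁
      σ₁ u = fromVL u (partner pm (VL u))
      σ₁-partner : ∀ u → u ≢ x₁ → VL (σ₁ u) ≡ partner pm (VL u) × σ₁ u ≢ x₁
      σ₁-partner u u≢x₁ = let u′ , p , u′≢x₁ = partner-VL u u≢x₁ ; σ₁u≡u′ = fromVL-VL (sym p) in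
        trans (cong VL σ₁u≡u′) (sym p) , subst (_≢ x₁) (sym σ₁u≡u′) u′≢x₁
      open IsPairing (partner-isPairing pm (λ _ → true) λ _ _ → refl)
      σ₁-pairing : IsPairing σ₁ (without (λ _ → true) x₁)
      σ₁-pairing = record
        { closed       = λ u h → without-true (λ _ → true) refl (proj₂ (σ₁-partner u (≢x₁ h)))
        ; fixpointFree = λ u h σ₁u≡u → fixpointFree (VL u) refl (trans (sym (proj₁ (σ₁-partner u (≢x₁ h)))) (cong VL σ₁u≡u))
        ; involutive   = λ u h → fromVL-VL (sym (trans (cong (partner pm) (proj₁ (σ₁-partner u (≢x₁ h)))) (involutive (VL u) refl)))
        }
        where
          ≢x₁ : ∀ {u} → without (λ _ → true) x₁ u ≡ true → u ≢ x₁
          ≢x₁ {u} h = proj₂ (without-true⁻ (λ _ → true) x₁ u h)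

  restrict-perfectMatching : ∀ {M} → PerfectMatching G M → M (EL e₁) ≡ M (ER e₂) → PerfectMatching G₁ (M ∘ EL)
  restrict-perfectMatching {M} pm f₁∼f₂ = (λ a _ → L.matchingCovered⇒nonLoop mc₁ a) , covers
    where
      covers : ∀ u → Σ (Edge G₁) λ a → M (EL a) ≡ true × Inc G₁ u a × (∀ a′ → M (EL a′) ≡ true → Inc G₁ u a′ → a′ ≡ a)
      covers u with proj₂ pm (VL u)
      ... | g , g∈M , u∈g , unique with VL-Inc-cases u∈g
      ... | inj₁ (a , refl , a≢e₁ , u∈a) = a , g∈M , u∈a , only
        where
          only : ∀ a′ → M (EL a′) ≡ true → Inc G₁ u a′ → a′ ≡ a
          only a′ a′∈M u∈a′ with a′ ≟ e₁
          ... | no a′≢e₁ = EL-injective (unique (EL a′) a′∈M (EL-Inc a′≢e₁ u∈a′))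
          ... | yes refl with L.Inc-Joins e₁-joins u∈a′
          ...   | inj₁ refl = ⊥-elim (a≢e₁ (sym (EL-injective (unique (EL e₁) a′∈M (Joins⇒Inc₁ f₁-joins)))))
          ...   | inj₂ refl = ⊥-elim (EL≢ER (sym (unique (ER e₂) (trans (sym f₁∼f₂) a′∈M) (Joins⇒Inc₁ f₂-joins))))
      ... | inj₂ (inj₁ (refl , refl)) = e₁ , g∈M , L.Joins⇒Inc₁ e₁-joins , only
        where
          only : ∀ a′ → M (EL a′) ≡ true → Inc G₁ x₁ a′ → a′ ≡ e₁
          only a′ a′∈M u∈a′ with a′ ≟ e₁
          ... | yes a′≡e₁ = a′≡e₁
          ... | no  a′≢e₁ = EL-injective (unique (EL a′) a′∈M (EL-Inc a′≢e₁ u∈a′))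
      ... | inj₂ (inj₂ (refl , refl)) = e₁ , trans f₁∼f₂ g∈M , L.Joins⇒Inc₂ e₁-joins , only
        where
          only : ∀ a′ → M (EL a′) ≡ true → Inc G₁ y₁ a′ → a′ ≡ e₁
          only a′ a′∈M u∈a′ with a′ ≟ e₁
          ... | yes a′≡e₁ = a′≡e₁
          ... | no  a′≢e₁ = ⊥-elim (EL≢ER (unique (EL a′) a′∈M (EL-Inc a′≢e₁ u∈a′)))

  ∇-restrict : ∀ (U : VertexSet G) a → a ≢ e₁ → ∇ G U (EL a) ≡ ∇ G₁ (U ∘ VL) a
  ∇-restrict U a a≢e₁ rewrite EL-ends a a≢e₁ = refl

  ∼all⇒bipartite : (S′ : EdgeSet G) → Sim G S′ (allEdges G) → BipartiteSub G₁ (minusEdges G₁ e₁ (S′ ∘ EL))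
  ∼all⇒bipartite S′ (U , S′≡∇) = U ∘ VL , λ a a∈H → let a≢e₁ , a∉S′ = ∧-true⁻ {not (does (a ≟ e₁))} a∈H in
    xor-true⁻ (trans (sym (∇-restrict U a (not-does-true⁻ {a? = a ≟ e₁} a≢e₁)))
      (trans (sym (not-involutive _)) (trans (cong not (sym (S′≡∇ (EL a) refl))) a∉S′)))

  ∼∅⇒restriction-∼∅ : (S′ : EdgeSet G) → Sim G S′ (noEdges G) → SimSub G₁ (minusEdge G₁ e₁) (S′ ∘ EL) (noEdges G₁)
  ∼∅⇒restriction-∼∅ S′ (U , S′≡∇) = U ∘ VL , λ a a∈H → trans (S′≡∇ (EL a) refl) (∇-restrict U a (not-does-true⁻ {a? = a ≟ e₁} a∈H))

  degree-VL : ∀ v → degree G (VL v) ≡ degree G₁ v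
  degree-VL v = begin
    degree G (VL v)                           ≡⟨ degree-sum G (VL v) ⟩
    sum (endsAt G (VL v))                     ≡⟨ sum-split (endsAt G (VL v)) ⟩
    sum left + sum right                      ≡⟨ cong₂ _+_ (sum-except e₁ left) (sum-except e₂ right) ⟩
    (left e₁ + sum (except e₁ left)) + (right e₂ + sum (except e₂ right))
      ≡⟨ cong₂ (λ s t → (left e₁ + s) + (right e₂ + t)) (sum-cong-≗ (except-cong left≗)) (sum-except-zero right≗0) ⟩
    (left e₁ + rest) + (right e₂ + 0)         ≡⟨ cong₂ (λ s t → (s + rest) + (t + 0)) (f-ends f₁-joins) (f-ends f₂-joins) ⟩
    ((⟦ x₁ ⟧ + 0) + rest) + ((⟦ y₁ ⟧ + 0) + 0) ≡⟨ rearrange ⟦ x₁ ⟧ ⟦ y₁ ⟧ rest ⟩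
    (⟦ x₁ ⟧ + ⟦ y₁ ⟧) + rest                 ≡⟨ cong (_+ rest) (sym (endsAt-Joins G₁ v e₁-joins)) ⟩
    endsAt G₁ v e₁ + rest                     ≡⟨ sym (sum-except e₁ (endsAt G₁ v)) ⟩
    sum (endsAt G₁ v)                         ≡⟨ sym (degree-sum G₁ v) ⟩
    degree G₁ v                               ∎
    where
      open ≡-Reasoning
      ⟦_⟧ : Vertex G₁ → ℕ
      ⟦ u ⟧ = indicator (does (u ≟ v))
      left : Edge G₁ → ℕ
      left = endsAt G (VL v) ∘ EL
      right : Edge G₂ → ℕ
      right = endsAt G (VL v) ∘ ER
      rest : ℕ
      rest = sum (except e₁ (endsAt G₁ v))
      VL-≟ : ∀ u → indicator (does (VL u ≟ VL v)) ≡ ⟦ u ⟧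
      VL-≟ u with u ≟ v
      ... | yes refl = cong indicator (dec-true (VL u ≟ VL u) refl)
      ... | no  u≢v  = cong indicator (dec-false (VL u ≟ VL v) (u≢v ∘ VL-injective))
      VR-≟ : ∀ z → indicator (does (VR z ≟ VL v)) ≡ 0
      VR-≟ z = cong indicator (dec-false (VR z ≟ VL v) (VL≢VR ∘ sym))
      left≗ : ∀ a → a ≢ e₁ → left a ≡ endsAt G₁ v a
      left≗ a a≢e₁ = trans (endsAt-Joins G (VL v) (EL-joins a≢e₁ (inj₁ refl))) (cong₂ _+_ (VL-≟ _) (VL-≟ _))
      right≗0 : ∀ b → b ≢ e₂ → right b ≡ 0
      right≗0 b b≢e₂ = trans (endsAt-Joins G (VL v) (inj₁ (ER-ends b b≢e₂))) (cong₂ _+_ (VR-≟ _) (VR-≟ _))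
      f-ends : ∀ {g u z} → Joins G g (VL u) (VR z) → endsAt G (VL v) g ≡ ⟦ u ⟧ + 0
      f-ends j = trans (endsAt-Joins G (VL v) j) (cong₂ _+_ (VL-≟ _) (VR-≟ _))
      rearrange : ∀ a b c → ((a + 0) + c) + ((b + 0) + 0) ≡ (a + b) + c
      rearrange = solve-∀

module Sides {G₁ G₂ G : Graph} {e₁ : Edge G₁} {e₂ : Edge G₂} {x₁ y₁ : Vertex G₁} {x₂ y₂ : Vertex G₂}
             (gl : Gluing G₁ G₂ G e₁ e₂ x₁ y₁ x₂ y₂) where
  open Gluing gl
  open Properties G
  private
    module L = Properties G₁
    module R = Properties G₂
    module S₁ = Side gl
    module S₂ = Side (Gluing-swap gl)

  combine : ∀ {A : Set} → (Edge G₁ → A) → (Edge G₂ → A) → Edge G → A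
  combine c₁ c₂ g with edge-split g
  ... | inj₁ (a , _) = c₁ a
  ... | inj₂ (b , _) = c₂ b

  combine-EL : ∀ {A : Set} (c₁ : Edge G₁ → A) (c₂ : Edge G₂ → A) a → combine c₁ c₂ (EL a) ≡ c₁ a
  combine-EL c₁ c₂ a with edge-split (EL a)
  ... | inj₁ (a′ , p) = cong c₁ (EL-injective p)
  ... | inj₂ (b , p)  = ⊥-elim (EL≢ER (sym p))

  combine-ER : ∀ {A : Set} (c₁ : Edge G₁ → A) (c₂ : Edge G₂ → A) b → combine c₁ c₂ (ER b) ≡ c₂ b
  combine-ER c₁ c₂ b with edge-split (ER b)
  ... | inj₁ (a , p)  = ⊥-elim (EL≢ER p)
  ... | inj₂ (b′ , p) = cong c₂ (ER-injective p)

  combine-perfectMatching : ∀ {M₁ M₂} → PerfectMatching G₁ M₁ → PerfectMatching G₂ M₂ → M₁ e₁ ≡ M₂ e₂ →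
    PerfectMatching G (combine M₁ M₂)
  combine-perfectMatching {M₁} {M₂} pm₁ pm₂ e₁∼e₂ = nonLoop , covers
    where
      nonLoop : ∀ g → combine M₁ M₂ g ≡ true → NonLoop G g
      nonLoop g _ with edge-split g
      ... | inj₁ (a , refl) = S₁.EL-nonLoop a
      ... | inj₂ (b , refl) = S₂.EL-nonLoop b
      covers : ∀ w → Σ (Edge G) λ g → combine M₁ M₂ g ≡ true × Inc G w g ×
                 (∀ g′ → combine M₁ M₂ g′ ≡ true → Inc G w g′ → g′ ≡ g)
      covers w with vertex-split w
      ... | inj₁ (u , refl) = S₁.combined-covers-VL pm₁ pm₂ e₁∼e₂ _ (combine-EL M₁ M₂) (combine-ER M₁ M₂) u
      ... | inj₂ (v , refl) = S₂.combined-covers-VL pm₂ pm₁ (sym e₁∼e₂) _ (combine-ER M₁ M₂) (combine-EL M₁ M₂) v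

  -- A perfect matching of G₁ through a extends by one of G₂ that agrees with it on e₂; when e₁ is
  -- not used, this is where 2 ≤ m G₂ is needed.
  EL-matchable : ∀ a → Σ (EdgeSet G) λ M → PerfectMatching G M × M (EL a) ≡ true
  EL-matchable a with proj₂ mc₁ a
  ... | M₁ , pm₁ , a∈M₁ with M₁ e₁ in e₁∈M₁
  ...   | true  = let M₂ , pm₂ , e₂∈M₂ = proj₂ mc₂ e₂ in
          combine M₁ M₂ , combine-perfectMatching pm₁ pm₂ (trans e₁∈M₁ (sym e₂∈M₂)) , trans (combine-EL M₁ M₂ a) a∈M₁
  ...   | false = let M₂ , pm₂ , e₂∉M₂ = perfectMatching-avoiding G₂ e₂-joins mc₂ 2≤m₂ in
          combine M₁ M₂ , combine-perfectMatching pm₁ pm₂ (trans e₁∈M₁ (sym e₂∉M₂)) , trans (combine-EL M₁ M₂ a) a∈M₁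

  edge-cases : (P : Edge G → Set) → (∀ a → P (EL a)) → (∀ b → P (ER b)) → ∀ g → P g
  edge-cases P P-L P-R g with edge-split g
  ... | inj₁ (a , refl) = P-L a
  ... | inj₂ (b , refl) = P-R b

  ⇝VLx₁ : ∀ w → Star (Adj G) w (VL x₁)
  ⇝VLx₁ w with vertex-split w
  ... | inj₁ (u , refl) = S₁.VL⇝VLx₁ u
  ... | inj₂ (v , refl) = S₂.VL⇝VLx₁ v ◅◅ (ER e₂ , Joins-sym f₂-joins) ◅ S₁.VL-bypass λ a≢e₁ j → EL _ , S₁.EL-joins a≢e₁ j

  glued-connected : Connected G
  glued-connected u v = ⇝VLx₁ u ◅◅ reverse (λ (g , j) → g , Joins-sym j) (⇝VLx₁ v)

  f₁∼f₂ : ∀ {M} → PerfectMatching G M → M (EL e₁) ≡ M (ER e₂)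
  f₁∼f₂ {M} pm with M (EL e₁) in f₁∈M | M (ER e₂) in f₂∈M
  ... | true  | true  = refl
  ... | false | false = refl
  ... | true  | false = ⊥-elim (true≢false (trans (sym (S₁.f₁∈M⇒f₂∈M pm f₁∈M)) f₂∈M))
  ... | false | true  = ⊥-elim (true≢false (trans (sym (S₂.f₁∈M⇒f₂∈M pm f₂∈M)) f₁∈M))

  glued-equivalentSet : ∀ {S₁ S₂} (S : EdgeSet G) → EquivalentSet G₁ S₁ → EquivalentSet G₂ S₂ →
    S₁ e₁ ≡ true → S₂ e₂ ≡ true → S (EL e₁) ≡ true →
    (∀ a → a ≢ e₁ → S (EL a) ≡ S₁ a) → (∀ b → b ≢ e₂ → S (ER b) ≡ S₂ b) → EquivalentSet G S
  glued-equivalentSet {S₁} {S₂} S (_ , equiv₁) (_ , equiv₂) e₁∈S₁ e₂∈S₂ f₁∈S S-L S-R = (EL e₁ , f₁∈S) , uniform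
    where
      uniform : ∀ M → PerfectMatching G M → ConstantOn S M false ⊎ ConstantOn S M true
      uniform M pm with constantOn (equiv₁ _ (S₁.restrict-perfectMatching pm (f₁∼f₂ pm)))
                      | constantOn (equiv₂ _ (S₂.restrict-perfectMatching pm (sym (f₁∼f₂ pm))))
      ... | β₁ , on₁ | β₂ , on₂ = constantOn⁻ (β₁ , edge-cases (λ g → S g ≡ true → M g ≡ β₁) on-L on-R)
        where
          β₂≡β₁ : β₂ ≡ β₁
          β₂≡β₁ = trans (sym (on₂ e₂ e₂∈S₂)) (trans (sym (f₁∼f₂ pm)) (on₁ e₁ e₁∈S₁))
          on-L : ∀ a → S (EL a) ≡ true → M (EL a) ≡ β₁
          on-L a a∈S with a ≟ e₁
          ... | yes refl = on₁ e₁ e₁∈S₁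
          ... | no a≢e₁  = on₁ a (trans (sym (S-L a a≢e₁)) a∈S)
          on-R : ∀ b → S (ER b) ≡ true → M (ER b) ≡ β₁
          on-R b b∈S with b ≟ e₂
          ... | yes refl = trans (on₂ e₂ e₂∈S₂) β₂≡β₁
          ... | no b≢e₂  = trans (on₂ b (trans (sym (S-R b b≢e₂)) b∈S)) β₂≡β₁

  glued-regular : ∀ r → Regular G₁ r → Regular G₂ r → Regular G r
  glued-regular r regular₁ regular₂ w with vertex-split w
  ... | inj₁ (u , refl) = trans (S₁.degree-VL u) (regular₁ u)
  ... | inj₂ (v , refl) = trans (S₂.degree-VL v) (regular₂ v)

  combine-proper-EL : ∀ {k} {c₁ : Edge G₁ → Fin k} {c₂ : Edge G₂ → Fin k} {c : Edge G → Fin k} →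
    ProperEdgeColouring G₁ k c₁ → ProperEdgeColouring G₂ k c₂ → c₁ e₁ ≡ c₂ e₂ →
    (∀ a → c (EL a) ≡ c₁ a) → (∀ b → c (ER b) ≡ c₂ b) →
    ∀ a g′ → EL a ≢ g′ → (Σ (Vertex G) λ w → Inc G w (EL a) × Inc G w g′) → c (EL a) ≢ c g′
  combine-proper-EL {c₁ = c₁} {c₂} {c} proper₁ proper₂ e₁∼e₂ c-L c-R a g′ a≢g′ (w , w∈a , w∈g′) eq with a ≟ e₁
  ... | no a≢e₁ with S₁.EL-Inc⁻ a≢e₁ w∈a
  ...   | u , refl , u∈a with S₁.VL-Inc-cases w∈g′
  ...     | inj₁ (a′ , refl , _ , u∈a′) =
            proper₁ a a′ (a≢g′ ∘ cong EL) (u , u∈a , u∈a′) (trans (sym (c-L a)) (trans eq (c-L a′)))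
  ...     | inj₂ (inj₁ (refl , refl)) =
            proper₁ a e₁ a≢e₁ (x₁ , u∈a , L.Joins⇒Inc₁ e₁-joins) (trans (sym (c-L a)) (trans eq (c-L e₁)))
  ...     | inj₂ (inj₂ (refl , refl)) =
            proper₁ a e₁ a≢e₁ (y₁ , u∈a , L.Joins⇒Inc₂ e₁-joins) (trans (sym (c-L a)) (trans eq (trans (c-R e₂) (sym e₁∼e₂))))
  combine-proper-EL {c₁ = c₁} {c₂} {c} proper₁ proper₂ e₁∼e₂ c-L c-R a g′ a≢g′ (w , w∈a , w∈g′) eq | yes refl
    with Inc-Joins f₁-joins w∈a
  ... | inj₁ refl with S₁.VL-Inc-cases w∈g′
  ...   | inj₁ (a′ , refl , a′≢e₁ , x₁∈a′) =
          proper₁ e₁ a′ (a′≢e₁ ∘ sym) (x₁ , L.Joins⇒Inc₁ e₁-joins , x₁∈a′) (trans (sym (c-L e₁)) (trans eq (c-L a′)))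
  ...   | inj₂ (inj₁ (refl , _))   = a≢g′ refl
  ...   | inj₂ (inj₂ (_ , x₁≡y₁)) = S₁.x₁≢y₁ x₁≡y₁
  combine-proper-EL {c₁ = c₁} {c₂} {c} proper₁ proper₂ e₁∼e₂ c-L c-R a g′ a≢g′ (w , w∈a , w∈g′) eq | yes refl
    | inj₂ refl with S₂.VL-Inc-cases w∈g′
  ...   | inj₁ (b , refl , b≢e₂ , x₂∈b) =
          proper₂ e₂ b (b≢e₂ ∘ sym) (x₂ , R.Joins⇒Inc₁ e₂-joins , x₂∈b) (trans (sym e₁∼e₂) (trans (sym (c-L e₁)) (trans eq (c-R b))))
  ...   | inj₂ (inj₁ (_ , x₂≡y₂))  = S₂.x₁≢y₁ (sym x₂≡y₂)
  ...   | inj₂ (inj₂ (refl , _))   = a≢g′ refl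

  AdjAvoiding-sym : ∀ {w u v} → AdjAvoiding G w u v → AdjAvoiding G w v u
  AdjAvoiding-sym ((g , j) , u≢w , v≢w) = (g , Joins-sym j) , v≢w , u≢w

  VRy₂⇝VRx₂-avoiding-VL : ∀ w₁ → Star (AdjAvoiding G (VL w₁)) (VR y₂) (VR x₂)
  VRy₂⇝VRx₂-avoiding-VL w₁ = reverse AdjAvoiding-sym
    (S₂.VL-bypass λ b≢e₂ j → (ER _ , S₂.EL-joins b≢e₂ j) , VL≢VR ∘ sym , VL≢VR ∘ sym)

  ⇝VRx₂-avoiding-VL : TwoConnected G₁ → ∀ w₁ z → z ≢ VL w₁ → Star (AdjAvoiding G (VL w₁)) z (VR x₂)
  ⇝VRx₂-avoiding-VL tc₁ w₁ z z≢w₁ with vertex-split z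
  ... | inj₁ (u , refl) with S₁.VL⇝x₁y₁-avoiding-VL tc₁ w₁ u (z≢w₁ ∘ cong VL)
  ...   | _ , (inj₁ refl , x₁≢w₁) , path = path ◅◅ ((EL e₁ , f₁-joins) , x₁≢w₁ ∘ VL-injective , VL≢VR ∘ sym) ◅ ε
  ...   | _ , (inj₂ refl , y₁≢w₁) , path =
          path ◅◅ ((ER e₂ , f₂-joins) , y₁≢w₁ ∘ VL-injective , VL≢VR ∘ sym) ◅ VRy₂⇝VRx₂-avoiding-VL w₁
  ⇝VRx₂-avoiding-VL tc₁ w₁ z z≢w₁ | inj₂ (v , refl) with S₂.VL⇝x₁y₁-avoiding (VL w₁) (λ _ → VL≢VR ∘ sym) v
  ...   | _ , inj₁ refl , path = path ◅◅ VRy₂⇝VRx₂-avoiding-VL w₁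
  ...   | _ , inj₂ refl , path = path

module Glued {G₁ G₂ G : Graph} {e₁ : Edge G₁} {e₂ : Edge G₂} {x₁ y₁ : Vertex G₁} {x₂ y₂ : Vertex G₂}
             (gl : Gluing G₁ G₂ G e₁ e₂ x₁ y₁ x₂ y₂) where
  open Gluing gl
  open Sides gl
  private
    module S₂ = Sides (Gluing-swap gl)

  glued-matchingCovered : MatchingCovered G
  glued-matchingCovered = glued-connected , edge-cases (λ g → Σ (EdgeSet G) λ M → PerfectMatching G M × M g ≡ true)
    EL-matchable S₂.EL-matchable

  combine-proper : ∀ {k} {c₁ : Edge G₁ → Fin k} {c₂ : Edge G₂ → Fin k} →
    ProperEdgeColouring G₁ k c₁ → ProperEdgeColouring G₂ k c₂ → c₁ e₁ ≡ c₂ e₂ → ProperEdgeColouring G k (combine c₁ c₂)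
  combine-proper {c₁ = c₁} {c₂} proper₁ proper₂ e₁∼e₂ = edge-cases _
    (combine-proper-EL proper₁ proper₂ e₁∼e₂ (combine-EL c₁ c₂) (combine-ER c₁ c₂))
    (S₂.combine-proper-EL proper₂ proper₁ (sym e₁∼e₂) (combine-ER c₁ c₂) (combine-EL c₁ c₂))

  glued-class1 : ∀ r → Regular G₁ r → Class1 G₁ → Regular G₂ r → Class1 G₂ → Class1 G
  glued-class1 r regular₁ ((c₁ , proper₁) , _) regular₂ ((c₂ , proper₂) , _)
    rewrite regular-maxDegree G₁ x₁ regular₁ | regular-maxDegree G₂ x₂ regular₂
          | regular-maxDegree G (VL x₁) (glued-regular r regular₁ regular₂) =
    (combine c₁ c₂′ , combine-proper proper₁ proper₂′ (sym (transpose-matchˡ (c₂ e₂) (c₁ e₁)))) , lower-bound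
    where
      c₂′ : Edge G₂ → Fin r
      c₂′ = transpose (c₂ e₂) (c₁ e₁) ∘ c₂
      proper₂′ : ProperEdgeColouring G₂ r c₂′
      proper₂′ b b′ b≢b′ shared = proper₂ b b′ b≢b′ shared ∘ transpose-injective (c₂ e₂) (c₁ e₁)
      lower-bound : ∀ k → EdgeColourable G k → r ≤ k
      lower-bound k (c , proper) = subst (_≤ k) (glued-regular r regular₁ regular₂ (VL x₁))
        (proper⇒degree≤ G (Properties.matchingCovered⇒nonLoop G glued-matchingCovered) proper (VL x₁))

  glued-twoConnected : TwoConnected G₁ → TwoConnected G₂ → TwoConnected G
  glued-twoConnected tc₁ tc₂ = ≤-trans (proj₁ tc₁) n₁≤n , glued-connected , avoiding
    where
      avoiding : ∀ (w u v : Vertex G) → u ≢ w → v ≢ w → Star (AdjAvoiding G w) u v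
      avoiding w u v u≢w v≢w with vertex-split w
      ... | inj₁ (w₁ , refl) = ⇝VRx₂-avoiding-VL tc₁ w₁ u u≢w ◅◅ reverse AdjAvoiding-sym (⇝VRx₂-avoiding-VL tc₁ w₁ v v≢w)
      ... | inj₂ (w₂ , refl) = S₂.⇝VRx₂-avoiding-VL tc₂ w₂ u u≢w ◅◅ reverse AdjAvoiding-sym (S₂.⇝VRx₂-avoiding-VL tc₂ w₂ v v≢w)

module Concrete (G₁ G₂ : Graph) (e₁ : Edge G₁) (e₂ : Edge G₂) (x₁ y₁ : Vertex G₁) (x₂ y₂ : Vertex G₂) where
  private
    G : Graph
    G = glue G₁ G₂ e₁ e₂ x₁ y₁ x₂ y₂

  glue-gluing : MatchingCovered G₁ → MatchingCovered G₂ → 2 ≤ m G₁ → 2 ≤ m G₂ →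
    Joins G₁ e₁ x₁ y₁ → Joins G₂ e₂ x₂ y₂ → Gluing G₁ G₂ G e₁ e₂ x₁ y₁ x₂ y₂
  glue-gluing mc₁ mc₂ 2≤m₁ 2≤m₂ e₁-joins e₂-joins = record
    { VL = vL G₁ G₂ ; VR = vR G₁ G₂ ; EL = eL G₁ G₂ ; ER = eR G₁ G₂
    ; VL-injective = ↑ˡ-injective (n G₂) _ _
    ; VR-injective = ↑ʳ-injective (n G₁) _ _
    ; VL≢VR        = ↑ˡ≢↑ʳ (n G₁) (n G₂)
    ; EL-injective = ↑ˡ-injective (m G₂) _ _
    ; ER-injective = ↑ʳ-injective (m G₁) _ _
    ; EL≢ER        = ↑ˡ≢↑ʳ (m G₁) (m G₂)
    ; vertex-split = ↑-split (n G₁) (n G₂)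
    ; edge-split   = ↑-split (m G₁) (m G₂)
    ; EL-ends      = EL-ends
    ; ER-ends      = ER-ends
    ; f₁-joins     = inj₁ f₁-ends
    ; f₂-joins     = inj₁ f₂-ends
    ; e₁-joins = e₁-joins ; e₂-joins = e₂-joins ; mc₁ = mc₁ ; mc₂ = mc₂ ; 2≤m₁ = 2≤m₁ ; 2≤m₂ = 2≤m₂
    ; sum-split    = sum-↑ (m G₁) (m G₂)
    ; n₁≤n         = m≤m+n (n G₁) (n G₂)
    ; n₂≤n         = m≤n+m (n G₂) (n G₁)
    }
    where
      EL-ends : ∀ a → a ≢ e₁ → ends G (eL G₁ G₂ a) ≡ (vL G₁ G₂ (proj₁ (ends G₁ a)) , vL G₁ G₂ (proj₂ (ends G₁ a)))
      EL-ends a a≢e₁ rewrite splitAt-↑ˡ (m G₁) a (m G₂) | dec-false (a ≟ e₁) a≢e₁ = refl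
      ER-ends : ∀ b → b ≢ e₂ → ends G (eR G₁ G₂ b) ≡ (vR G₁ G₂ (proj₁ (ends G₂ b)) , vR G₁ G₂ (proj₂ (ends G₂ b)))
      ER-ends b b≢e₂ rewrite splitAt-↑ʳ (m G₁) (m G₂) b | dec-false (b ≟ e₂) b≢e₂ = refl
      f₁-ends : ends G (eL G₁ G₂ e₁) ≡ (vL G₁ G₂ x₁ , vR G₁ G₂ x₂)
      f₁-ends rewrite splitAt-↑ˡ (m G₁) e₁ (m G₂) | dec-true (e₁ ≟ e₁) refl = refl
      f₂-ends : ends G (eR G₁ G₂ e₂) ≡ (vL G₁ G₂ y₁ , vR G₁ G₂ y₂)
      f₂-ends rewrite splitAt-↑ʳ (m G₁) (m G₂) e₂ | dec-true (e₂ ≟ e₂) refl = refl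

  module _ (S₁ : EdgeSet G₁) (S₂ : EdgeSet G₂) where
    private
      S : EdgeSet G
      S = glueSet G₁ G₂ e₁ e₂ S₁ S₂

    glueSet-f₁ : S (eL G₁ G₂ e₁) ≡ true
    glueSet-f₁ rewrite splitAt-↑ˡ (m G₁) e₁ (m G₂) | dec-true (e₁ ≟ e₁) refl = refl

    glueSet-EL : ∀ a → a ≢ e₁ → S (eL G₁ G₂ a) ≡ S₁ a
    glueSet-EL a a≢e₁ rewrite splitAt-↑ˡ (m G₁) a (m G₂) | dec-false (a ≟ e₁) a≢e₁ = refl

    glueSet-ER : ∀ b → b ≢ e₂ → S (eR G₁ G₂ b) ≡ S₂ b
    glueSet-ER b b≢e₂ rewrite splitAt-↑ʳ (m G₁) (m G₂) b | dec-false (b ≟ e₂) b≢e₂ = refl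

lemma5p1 : (G₁ G₂ : Graph) (e₁ : Edge G₁) (e₂ : Edge G₂)
    (x₁ y₁ : Vertex G₁) (x₂ y₂ : Vertex G₂) (S₁ : EdgeSet G₁) (S₂ : EdgeSet G₂) →
    MatchingCovered G₁ → MatchingCovered G₂ →
    2 ≤ m G₁ → 2 ≤ m G₂ →
    EquivalentSet G₁ S₁ → EquivalentSet G₂ S₂ →
    S₁ e₁ ≡ true → S₂ e₂ ≡ true →
    Joins G₁ e₁ x₁ y₁ → Joins G₂ e₂ x₂ y₂ →
    let G = glue G₁ G₂ e₁ e₂ x₁ y₁ x₂ y₂
        S = glueSet G₁ G₂ e₁ e₂ S₁ S₂
    in MatchingCovered G
     × EquivalentSet G S
     × (TwoConnected G₁ → TwoConnected G₂ → TwoConnected G)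
     × (∀ (r : ℕ) → Regular G₁ r → Class1 G₁ → Regular G₂ r → Class1 G₂ →
          Regular G r × Class1 G)
     × (∀ (S′ : EdgeSet G) → _⊆ₑ_ {G} S′ S →
          (¬ BipartiteSub G₁ (minusEdges G₁ e₁ (restrictL G₁ G₂ S′))
           ⊎ ¬ BipartiteSub G₂ (minusEdges G₂ e₂ (restrictR G₁ G₂ S′))) →
          ¬ Sim G S′ (allEdges G))
     × (∀ (S′ : EdgeSet G) → _⊆ₑ_ {G} S′ S →
          (¬ SimSub G₁ (minusEdge G₁ e₁) (restrictL G₁ G₂ S′) (noEdges G₁)
           ⊎ ¬ SimSub G₂ (minusEdge G₂ e₂) (restrictR G₁ G₂ S′) (noEdges G₂)) →
          ¬ Sim G S′ (noEdges G))
lemma5p1 G₁ G₂ e₁ e₂ x₁ y₁ x₂ y₂ S₁ S₂ mc₁ mc₂ 2≤m₁ 2≤m₂ equiv₁ equiv₂ e₁∈S₁ e₂∈S₂ e₁-joins e₂-joins =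
  glued-matchingCovered ,
  glued-equivalentSet _ equiv₁ equiv₂ e₁∈S₁ e₂∈S₂ (glueSet-f₁ S₁ S₂)
    (glueSet-EL S₁ S₂) (glueSet-ER S₁ S₂) ,
  glued-twoConnected ,
  (λ r regular₁ class₁ regular₂ class₂ → glued-regular r regular₁ regular₂ , glued-class1 r regular₁ class₁ regular₂ class₂) ,
  -- (v) and (vi) do not need the hypothesis S′ ⊆ S.
  (λ S′ _ → Sum.[ (λ ¬bipartite → ¬bipartite ∘ L.∼all⇒bipartite S′) , (λ ¬bipartite → ¬bipartite ∘ R.∼all⇒bipartite S′) ]′) ,
  (λ S′ _ → Sum.[ (λ ≁∅ → ≁∅ ∘ L.∼∅⇒restriction-∼∅ S′) , (λ ≁∅ → ≁∅ ∘ R.∼∅⇒restriction-∼∅ S′) ]′)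
  where
    open Concrete G₁ G₂ e₁ e₂ x₁ y₁ x₂ y₂
    gl : Gluing G₁ G₂ (glue G₁ G₂ e₁ e₂ x₁ y₁ x₂ y₂) e₁ e₂ x₁ y₁ x₂ y₂
    gl = glue-gluing mc₁ mc₂ 2≤m₁ 2≤m₂ e₁-joins e₂-joins
    open Glued gl
    open Sides gl
    module L = Side gl
    module R = Side (Gluing-swap gl)
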